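{- Let $GQSym^{111}$ be the graded Hopf algebra with basis $(\mathbb{M}_G)$ described in the context, and let $\mathbf{GSym}^{111}$ be its graded dual Hopf algebra, with $(\mathbf{S}^G)$ the basis dual to $(\mathbb{M}_G)$. Then $\mathbf{GSym}^{111}$ is the free associative algebra on the set $\{\mathbf{S}^G \mid G \text{ irreducible}\}$.
   Context: $\mathbb{K}$ is a field of characteristic zero and $x_{ij}$ ($i,j\ge1$) commuting indeterminates. Graphs are labeled directed graphs with loops and multiple edges allowed, no isolated vertex, vertices numbered $1,\dots,m$; equivalently nonnegative integer matrices $A=(a_{ij})_{i,j=1}^m$ with no index $i$ such that $a_{ij}=a_{ji}=0$ for all $j$. For such $G$, $\mathbb{M}_G:=\sum_{i_1<\dots<i_m}\prod_{j,k=1}^m x_{i_ji_k}^{a_{jk}}$, and $GQSym^{111}$ is the $\mathbb{K}$-span of the $\mathbb{M}_G$ inside formal power series in the $x_{ij}$; it is an algebra under the ordinary product, graded by the total number of edges $\sum_{j,k}a_{jk}$. An integer $i\in[0,m]$ is an admissible cut of $G$ if no edge joins a vertex of $[1,i]$ and a vertex of $[i+1,m]$; $C_G$ is the set of admissible cuts. $G|_D$ is the restriction of $G$ to the vertex set $D\subseteq[1,m]$ with vertices renumbered $1,\dots,|D|$ in increasing order. The coproduct is $\Delta\mathbb{M}_G=\sum_{i\in C_G}\mathbb{M}_{G|_{[1,i]}}\otimes\mathbb{M}_{G|_{[i+1,m]}}$, making $GQSym^{111}$ a graded Hopf algebra. The product of $\mathbf{GSym}^{111}$ is the transpose of $\Delta$.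 A graph $G$ (with $m\ge1$) is irreducible if it has no admissible cut other than $0$ and $m$. -}

module Defs where

open import Level using (Level; _⊔_) renaming (suc to lsuc)
open import Algebra.Bundles using (CommutativeRing)
open import Data.Bool using (Bool; true; false; _∧_; _∨_; not; if_then_else_; T)
open import Data.Nat using (ℕ; zero; suc; _≡ᵇ_; _≤ᵇ_) renaming (_+_ to _+ℕ_)
open import Data.Nat using ( _∸_; _≤_; _<_)
import Data.Nat.Properties as ℕP
open import Data.Fin using (Fin; toℕ)
open import Data.List using (List; []; _∷_; map; foldr; upTo)
open import Data.Bool.ListAction using (all; any)
open import Data.Vec using (Vec; []; _∷_; tabulate; replicate)
import Data.Vec.Properties as VecP
import Data.Product.Properties as ProdP
open import Data.Product using (Σ; ∃; _×_; _,_; proj₁; proj₂)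
open import Relation.Nullary using (¬_; does)
open import Relation.Binary.PropositionalEquality using (_≡_)
open import Relation.Binary.Definitions using (DecidableEquality)

natCast : ∀ {c ℓ} (R : CommutativeRing c ℓ) → ℕ → CommutativeRing.Carrier R
natCast R zero    = CommutativeRing.0# R
natCast R (suc n) = CommutativeRing._+_ R (CommutativeRing.1# R) (natCast R n)

record CharZeroField (c ℓ : Level) : Set (lsuc (c ⊔ ℓ)) where
  field
    commutativeRing : CommutativeRing c ℓ
  open CommutativeRing commutativeRing
  field
    1≉0       : ¬ (1# ≈ 0#)
    inverse   : ∀ x → ¬ (x ≈ 0#) → Σ Carrier λ y → (x * y) ≈ 1#
    charZero  : ∀ n → ¬ (natCast commutativeRing (suc n) ≈ 0#)
  open CommutativeRing commutativeRing public

-- Raw graphs: a number m of vertices (numbered 0 .. m-1, i.e. the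
-- paper's 1 .. m shifted by one) and an m×m adjacency matrix of
-- nonnegative integers (a_jk = number of edges j → k).

Mat : ℕ → Set
Mat m = Vec (Vec ℕ m) m

RawGraph : Set
RawGraph = Σ ℕ Mat

_≟G_ : DecidableEquality RawGraph
_≟G_ = ProdP.≡-dec ℕP._≟_ (VecP.≡-dec (VecP.≡-dec ℕP._≟_))

getD : ∀ {A : Set} {n} → A → Vec A n → ℕ → A
getD d []       _       = d
getD d (x ∷ xs) zero    = x
getD d (x ∷ xs) (suc k) = getD d xs k

entry : ∀ {m} → Mat m → ℕ → ℕ → ℕ
entry {m} A j k = getD 0 (getD (replicate m 0) A j) k

noIsolatedᵇ : ∀ {m} → Mat m → Bool
noIsolatedᵇ {m} A =
  all (λ j → any (λ k → not (entry A j k ≡ᵇ 0) ∨ not (entry A k j ≡ᵇ 0)) (upTo m)) (upTo m)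

IsGraph : RawGraph → Set
IsGraph (m , A) = T (noIsolatedᵇ A)

size : RawGraph → ℕ
size = proj₁

admissibleᵇ : ∀ {m} → Mat m → ℕ → Bool
admissibleᵇ {m} A i =
  (i ≤ᵇ m) ∧
  all (λ j → all (λ k → (i ≤ᵇ k) ∧ (entry A j k ≡ᵇ 0) ∧ (entry A k j ≡ᵇ 0)
                        ∨ not (i ≤ᵇ k))
                 (upTo m))
      (upTo i)

Admissible : RawGraph → ℕ → Set
Admissible (m , A) i = T (admissibleᵇ A i)

restrictFst : RawGraph → ℕ → RawGraph
restrictFst (m , A) i = i , tabulate (λ a → tabulate (λ b → entry A (toℕ a) (toℕ b)))

restrictSnd : RawGraph → ℕ → RawGraph
restrictSnd (m , A) i =
  (m ∸ i) , tabulate (λ a → tabulate (λ b → entry A (i +ℕ toℕ a) (i +ℕ toℕ b)))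

Irreducible : RawGraph → Set
Irreducible G = IsGraph G × 1 ≤ size G ×
  (∀ i → Admissible G i → (i ≡ 0) Data.Sum.⊎ (i ≡ size G))
  where import Data.Sum

-- An element of GSym^111 is a finitely supported K-valued function on
-- graphs, f = Σ_G f(G) S^G (S^G dual to M_G).  We represent elements by
-- functions on raw graphs; only values on actual graphs (IsGraph) matter.

module GSym {c ℓ} (K : CharZeroField c ℓ) where
  open CharZeroField K

  Elt : Set c
  Elt = RawGraph → Carrier

  _≐_ : Elt → Elt → Set ℓ
  f ≐ g = ∀ G → IsGraph G → f G ≈ g G

  FinSupp : Elt → Set ℓ
  FinSupp f = Σ (List RawGraph) λ L →
    ∀ G → IsGraph G → ¬ (Data.List.Membership.Propositional._∈_ G L) → f G ≈ 0#
    where import Data.List.Membership.Propositional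

  S : RawGraph → Elt
  S H G = if does (H ≟G G) then 1# else 0#

  -- unit: S^∅ (dual to the counit), ∅ = graph with 0 vertices
  unit : Elt
  unit = S (0 , [])

  -- product = transpose of Δ:
  -- (f · g)(G) = Σ_{i ∈ C_G} f(G|[1,i]) g(G|[i+1,m])
  _·_ : Elt → Elt → Elt
  (f · g) G = foldr _+_ 0#
    (map (λ i → if admissibleᵇ (proj₂ G) i
                  then f (restrictFst G i) * g (restrictSnd G i)
                  else 0#)
         (upTo (suc (size G))))

  Word : Set
  Word = List RawGraph

  mono : Word → Elt
  mono w = foldr _·_ unit (map S w)

  lincomb : List (Carrier × Word) → Elt
  lincomb cs G = foldr _+_ 0# (map (λ p → proj₁ p * mono (proj₂ p) G) cs)

  -- GSym^111 is the free associative algebra on {S^G | G irreducible}: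
  -- the noncommutative monomials in these generators form a K-basis,
  -- i.e. they span GSym^111 and are linearly independent.
  IsFreeOnIrreducibles : Set (c ⊔ ℓ)
  IsFreeOnIrreducibles =
    (∀ f → FinSupp f →
       Σ (List (Carrier × Word)) λ cs →
         Data.List.Relation.Unary.All.All
           (λ p → Data.List.Relation.Unary.All.All Irreducible (proj₂ p)) cs
         × (f ≐ lincomb cs))
    ×
    (∀ (cs : List (Carrier × Word)) →
       Data.List.Relation.Unary.All.All
         (λ p → Data.List.Relation.Unary.All.All Irreducible (proj₂ p)) cs →
       Data.List.Relation.Unary.Unique.Propositional.Unique (map proj₂ cs) →
       lincomb cs ≐ (λ _ → 0#) →
       Data.List.Relation.Unary.All.All (λ p → proj₁ p ≈ 0#) cs)
    where
      import Data.List.Relation.Unary.All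
      import Data.List.Relation.Unary.Unique.Propositional

-- Unfolding the product, which is the transpose of the deconcatenation coproduct, the monomial
-- S^{H₁} ⋯ S^{H_k} takes the value 1 at G if G is obtained by stacking H₁, …, H_k along
-- admissible cuts, and 0 otherwise.  Every graph is such a stack of irreducible graphs in
-- exactly one way: split off the block ending at the least positive admissible cut and recurse;
-- conversely every word of irreducibles stacks to a graph (block-diagonal sum).  Hence the
-- monomials in irreducibles are the dual basis (S^G) reindexed along G ↦ its irreducible
-- factorisation, which gives both spanning and linear independence.
module Submission where

open import Level using (Level)
open import Defs
open import Data.Bool using (true; false; T; not; _∧_; _∨_; if_then_else_)
open import Data.Bool.Properties using (T-∧; T-∨)
open import Data.Nat using (ℕ; zero; suc; _+_; _∸_; _≤_; _<_; _≤ᵇ_; _≡ᵇ_; z≤n; s≤s; s≤s⁻¹; _≤?_; _<?_)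
open import Data.Nat.Properties
  using (≤ᵇ⇒≤; ≤⇒≤ᵇ; ≡ᵇ⇒≡; ≡⇒≡ᵇ; ∸-monoˡ-<; +-monoʳ-<; m+[n∸m]≡n; m+n∸m≡n; m≤m+n; m∸n≤m;
         ≤-refl; ≤-trans; <-≤-trans; <⇒≤; ≤⇒≯; <⇒≱; ≮⇒≥; >⇒≢; <⇒≢; <-cmp; m≤n⇒m<n∨m≡n; suc-injective)
open import Data.Fin using (toℕ)
open import Data.Vec using (Vec; []; _∷_; tabulate; replicate)
open import Data.List using (List; []; _∷_; map; foldr; upTo; applyUpTo; filter; deduplicate)
open import Data.List.Relation.Unary.Any using (here; there)
open import Data.List.Membership.Propositional using (_∈_; _∉_)
open import Data.List.Relation.Unary.Unique.Propositional using (Unique; _∷_)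
open import Data.List.Relation.Unary.Unique.DecPropositional.Properties _≟G_ using (deduplicate-!)
open import Data.List.Membership.DecPropositional _≟G_ using (_∈?_)
open import Data.List.Membership.Propositional.Properties using (∈-filter⁺; ∈-filter⁻; ∈-deduplicate⁺; ∈-deduplicate⁻)
open import Data.List.Relation.Unary.All using (All; []; _∷_)
import Data.List.Relation.Unary.All as All
import Data.List.Relation.Unary.All.Properties as AllP
import Data.List.Relation.Unary.Any.Properties as AnyP
open import Data.Product using (Σ; ∃-syntax; _×_; _,_; proj₁; proj₂)
open import Data.Sum using (_⊎_; inj₁; inj₂; [_,_]′)
import Data.Sum as Sum
open import Data.Empty using (⊥; ⊥-elim)
open import Function using (_∘_; _⇔_; mk⇔; Equivalence)
open import Relation.Nullary using (¬_; contradiction; yes; no)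
import Relation.Nullary.Decidable as Dec
open import Relation.Nullary.Decidable using (T?; dec-true; dec-false)
open import Relation.Unary using (Decidable)
open import Relation.Binary.PropositionalEquality using (_≡_; _≢_; refl; sym; trans; cong; cong₂; subst)
open import Relation.Binary.Definitions using (tri<; tri≈; tri>)
open import Algebra.Bundles using (Monoid)
open import Relation.Binary.Bundles using (Setoid)
open import Data.List.Properties using (map-upTo)

-- Adjacency matrices

edges : RawGraph → ℕ → ℕ → ℕ
edges (m , A) = entry A

getD-tabulate : ∀ {A : Set} {n} (d : A) (g : ℕ → A) {j} → j < n →
  getD d (tabulate {n = n} (g ∘ toℕ)) j ≡ g j
getD-tabulate {n = suc n} d g {zero}  _         = refl
getD-tabulate {n = suc n} d g {suc j} (s≤s j<n) = getD-tabulate d (g ∘ suc) j<n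

entry-tabulate : ∀ {m} (e : ℕ → ℕ → ℕ) {j k} → j < m → k < m →
  entry {m} (tabulate (λ a → tabulate (λ b → e (toℕ a) (toℕ b)))) j k ≡ e j k
entry-tabulate {m} e {j} {k} j<m k<m =
  trans (cong (λ row → getD 0 row k) (getD-tabulate (replicate m 0) (λ a → tabulate (e a ∘ toℕ)) j<m))
        (getD-tabulate 0 (e j) k<m)

getD-ext : ∀ {A : Set} (d : A) {n} (v w : Vec A n) →
  (∀ {j} → j < n → getD d v j ≡ getD d w j) → v ≡ w
getD-ext d []      []      _  = refl
getD-ext d (x ∷ v) (y ∷ w) eq = cong₂ _∷_ (eq (s≤s z≤n)) (getD-ext d v w (eq ∘ s≤s))

graph-ext : ∀ {G H} → size G ≡ size H →
  (∀ {j k} → j < size G → k < size G → edges G j k ≡ edges H j k) → G ≡ H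
graph-ext {m , A} {.m , B} refl eq =
  cong (m ,_) (getD-ext (replicate m 0) A B λ j<m → getD-ext 0 _ _ (eq j<m))

edges-restrictFst : ∀ G {i j k} → j < i → k < i → edges (restrictFst G i) j k ≡ edges G j k
edges-restrictFst (m , A) = entry-tabulate (entry A)

edges-restrictSnd : ∀ G {i j k} → j < size G ∸ i → k < size G ∸ i →
  edges (restrictSnd G i) j k ≡ edges G (i + j) (i + k)
edges-restrictSnd (m , A) {i} = entry-tabulate (λ a b → entry A (i + a) (i + b))

edges-restrictSnd-∸ : ∀ G {i j k} → i ≤ j → i ≤ k → j < size G → k < size G →
  edges (restrictSnd G i) (j ∸ i) (k ∸ i) ≡ edges G j k
edges-restrictSnd-∸ G i≤j i≤k j<m k<m =
  trans (edges-restrictSnd G (∸-monoˡ-< j<m i≤j) (∸-monoˡ-< k<m i≤k))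
        (cong₂ (edges G) (m+[n∸m]≡n i≤j) (m+[n∸m]≡n i≤k))

-- Cuts and isolated vertices

record Cut (G : RawGraph) (i : ℕ) : Set where
  constructor cut
  field
    bounded   : i ≤ size G
    separates : ∀ {j k} → j < i → i ≤ k → k < size G → edges G j k ≡ 0 × edges G k j ≡ 0
open Cut

Adjacent : RawGraph → ℕ → ℕ → Set
Adjacent G j k = edges G j k ≢ 0 ⊎ edges G k j ≢ 0

NoIsolated : RawGraph → Set
NoIsolated G = ∀ {j} → j < size G → ∃[ k ] k < size G × Adjacent G j k

T-guard : ∀ {b x} → T ((b ∧ x) ∨ not b) ⇔ (T b → T x)
T-guard {true}  {true}  = mk⇔ (λ _ _ → _) (λ _ → _)
T-guard {true}  {false} = mk⇔ (λ ()) (λ h → h _)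
T-guard {false}         = mk⇔ (λ _ ()) (λ _ → _)

T-≡ᵇ0 : ∀ {e} → T (e ≡ᵇ 0) ⇔ e ≡ 0
T-≡ᵇ0 {e} = mk⇔ (≡ᵇ⇒≡ e 0) (≡⇒≡ᵇ e 0)

T-not-≡ᵇ0 : ∀ {e} → T (not (e ≡ᵇ 0)) ⇔ e ≢ 0
T-not-≡ᵇ0 {zero}  = mk⇔ (λ ()) (λ e≢0 → e≢0 refl)
T-not-≡ᵇ0 {suc e} = mk⇔ (λ _ ()) (λ _ → _)

Admissible⇔Cut : ∀ G i → Admissible G i ⇔ Cut G i
Admissible⇔Cut (m , A) i = mk⇔ to from
  where
    to : Admissible (m , A) i → Cut (m , A) i
    to adm = cut (≤ᵇ⇒≤ i m i≤ᵇm) separated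
      where
        i≤ᵇm = proj₁ (Equivalence.to T-∧ adm)
        rows = AllP.all⁺ _ (upTo i) (proj₂ (Equivalence.to (T-∧ {i ≤ᵇ m}) adm))
        separated : ∀ {j k} → j < i → i ≤ k → k < m → entry A j k ≡ 0 × entry A k j ≡ 0
        separated {j} {k} j<i i≤k k<m =
          let row = AllP.all⁺ _ (upTo m) (AllP.applyUpTo⁻ _ i rows j<i)
              both = Equivalence.to T-∧ (Equivalence.to T-guard (AllP.applyUpTo⁻ _ m row k<m) (≤⇒≤ᵇ i≤k))
          in Equivalence.to T-≡ᵇ0 (proj₁ both) , Equivalence.to T-≡ᵇ0 (proj₂ both)
    from : Cut (m , A) i → Admissible (m , A) i
    from (cut i≤m separated) = Equivalence.from T-∧ (≤⇒≤ᵇ i≤m ,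
      AllP.all⁻ _ (AllP.applyUpTo⁺₁ _ i λ j<i → AllP.all⁻ _ (AllP.applyUpTo⁺₁ _ m λ k<m →
        Equivalence.from T-guard λ i≤ᵇk →
          let e₁ , e₂ = separated j<i (≤ᵇ⇒≤ i _ i≤ᵇk) k<m
          in Equivalence.from T-∧ (Equivalence.from T-≡ᵇ0 e₁ , Equivalence.from T-≡ᵇ0 e₂))))

IsGraph⇔NoIsolated : ∀ G → IsGraph G ⇔ NoIsolated G
IsGraph⇔NoIsolated (m , A) = mk⇔ to from
  where
    to : IsGraph (m , A) → NoIsolated (m , A)
    to g j<m =
      let k , k<m , adj = AnyP.applyUpTo⁻ _ (AnyP.any⁻ _ _ (AllP.applyUpTo⁻ _ m (AllP.all⁺ _ (upTo m) g) j<m))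
      in k , k<m , Sum.map (Equivalence.to T-not-≡ᵇ0) (Equivalence.to T-not-≡ᵇ0) (Equivalence.to T-∨ adj)
    from : NoIsolated (m , A) → IsGraph (m , A)
    from noIso = AllP.all⁻ _ (AllP.applyUpTo⁺₁ _ m λ j<m →
      let k , k<m , adj = noIso j<m
      in AnyP.any⁺ _ (AnyP.applyUpTo⁺ _ (Equivalence.from T-∨
           (Sum.map (Equivalence.from T-not-≡ᵇ0) (Equivalence.from T-not-≡ᵇ0) adj)) k<m))

Cut? : ∀ G → Decidable (Cut G)
Cut? G i = Dec.map (Admissible⇔Cut G i) (T? _)

IsGraph? : Decidable IsGraph
IsGraph? (m , A) = T? (noIsolatedᵇ A)

Adjacent-transport : ∀ G H {j k j′ k′} → edges G j k ≡ edges H j′ k′ → edges G k j ≡ edges H k′ j′ →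
  Adjacent G j k → Adjacent H j′ k′
Adjacent-transport G H e₁ e₂ = Sum.map (λ ne → ne ∘ trans e₁) (λ ne → ne ∘ trans e₂)

Cut⇒¬Adjacent : ∀ {G i j k} → Cut G i → j < i → i ≤ k → k < size G → ¬ Adjacent G j k
Cut⇒¬Adjacent c j<i i≤k k<m =
  let e₁ , e₂ = separates c j<i i≤k k<m in [ (λ ne → ne e₁) , (λ ne → ne e₂) ]′

Cut-size : ∀ G → Cut G (size G)
Cut-size G = cut ≤-refl λ _ m≤k k<m → contradiction k<m (≤⇒≯ m≤k)

NoIsolated-restrictFst : ∀ {G i} → NoIsolated G → Cut G i → NoIsolated (restrictFst G i)
NoIsolated-restrictFst {G} {i} noIso c {j} j<i with noIso (<-≤-trans j<i (bounded c))
... | k , k<m , adj with k <? i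
...   | yes k<i = k , k<i , Adjacent-transport G (restrictFst G i) (sym (edges-restrictFst G j<i k<i))
                                              (sym (edges-restrictFst G k<i j<i)) adj
...   | no  k≮i = contradiction adj (Cut⇒¬Adjacent c j<i (≮⇒≥ k≮i) k<m)

m<o∸n⇒n+m<o : ∀ {m n o} → n ≤ o → m < o ∸ n → n + m < o
m<o∸n⇒n+m<o {m} {n} n≤o m<o∸n = subst (n + m <_) (m+[n∸m]≡n n≤o) (+-monoʳ-< n m<o∸n)

NoIsolated-restrictSnd : ∀ {G i} → NoIsolated G → Cut G i → NoIsolated (restrictSnd G i)
NoIsolated-restrictSnd {G} {i} noIso c {j} j<m∸i with noIso (m<o∸n⇒n+m<o (bounded c) j<m∸i)
... | k , k<m , adj with k <? i
...   | yes k<i = contradiction (Sum.swap adj)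
                    (Cut⇒¬Adjacent c k<i (m≤m+n i j) (m<o∸n⇒n+m<o (bounded c) j<m∸i))
...   | no  k≮i = k ∸ i , ∸-monoˡ-< k<m i≤k ,
                  subst (λ j′ → Adjacent (restrictSnd G i) j′ (k ∸ i)) (m+n∸m≡n i j)
                    (Adjacent-transport G (restrictSnd G i) (sym (edges-restrictSnd-∸ G i≤j i≤k j′<m k<m))
                                        (sym (edges-restrictSnd-∸ G i≤k i≤j k<m j′<m)) adj)
  where
    i≤k = ≮⇒≥ k≮i
    i≤j = m≤m+n i j
    j′<m = m<o∸n⇒n+m<o (bounded c) j<m∸i

Cut-restrictFst : ∀ {G a b} → Cut G a → a ≤ b → b ≤ size G → Cut (restrictFst G b) a
Cut-restrictFst {G} {a} {b} c a≤b b≤m = cut a≤b λ j<a a≤k k<b →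
  let j<b = <-≤-trans j<a a≤b
      e₁ , e₂ = separates c j<a a≤k (<-≤-trans k<b b≤m)
  in trans (edges-restrictFst G j<b k<b) e₁ , trans (edges-restrictFst G k<b j<b) e₂

Cut-fromRestrictFst : ∀ {G i j} → Cut G i → Cut (restrictFst G i) j → Cut G j
Cut-fromRestrictFst {G} {i} {j} cᵢ cⱼ = cut (≤-trans (bounded cⱼ) (bounded cᵢ)) separated
  where
    separated : ∀ {x y} → x < j → j ≤ y → y < size G → edges G x y ≡ 0 × edges G y x ≡ 0
    separated {x} {y} x<j j≤y y<m with y <? i
    ... | no  y≮i = separates cᵢ (<-≤-trans x<j (bounded cⱼ)) (≮⇒≥ y≮i) y<m
    ... | yes y<i =
      let x<i = <-≤-trans x<j (bounded cⱼ)
          e₁ , e₂ = separates cⱼ x<j j≤y y<i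
      in trans (sym (edges-restrictFst G x<i y<i)) e₁ , trans (sym (edges-restrictFst G y<i x<i)) e₂

≡-fromCut : ∀ {G H a} → Cut G a → Cut H a →
  restrictFst G a ≡ restrictFst H a → restrictSnd G a ≡ restrictSnd H a → G ≡ H
≡-fromCut {G} {H} {a} cG cH fst≡ snd≡ = graph-ext m≡ same
  where
    m≡ : size G ≡ size H
    m≡ = trans (sym (m+[n∸m]≡n (bounded cG)))
               (trans (cong (a +_) (cong size snd≡)) (m+[n∸m]≡n (bounded cH)))
    same : ∀ {j k} → j < size G → k < size G → edges G j k ≡ edges H j k
    same {j} {k} j<m k<m with j <? a | k <? a
    ... | yes j<a | yes k<a = trans (sym (edges-restrictFst G j<a k<a))
                                (trans (cong (λ X → edges X j k) fst≡) (edges-restrictFst H j<a k<a))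
    ... | yes j<a | no  k≮a = trans (proj₁ (separates cG j<a (≮⇒≥ k≮a) k<m))
                                (sym (proj₁ (separates cH j<a (≮⇒≥ k≮a) (subst (k <_) m≡ k<m))))
    ... | no  j≮a | yes k<a = trans (proj₂ (separates cG k<a (≮⇒≥ j≮a) j<m))
                                (sym (proj₂ (separates cH k<a (≮⇒≥ j≮a) (subst (j <_) m≡ j<m))))
    ... | no  j≮a | no  k≮a =
      trans (sym (edges-restrictSnd-∸ G (≮⇒≥ j≮a) (≮⇒≥ k≮a) j<m k<m))
        (trans (cong (λ X → edges X (j ∸ a) (k ∸ a)) snd≡)
          (edges-restrictSnd-∸ H (≮⇒≥ j≮a) (≮⇒≥ k≮a) (subst (j <_) m≡ j<m) (subst (k <_) m≡ k<m)))

-- Block-diagonal sum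

blockDiag : ℕ → (ℕ → ℕ → ℕ) → (ℕ → ℕ → ℕ) → ℕ → ℕ → ℕ
blockDiag m e f j k with j <? m | k <? m
... | yes _ | yes _ = e j k
... | no  _ | no  _ = f (j ∸ m) (k ∸ m)
... | _     | _     = 0

blockDiag-fst : ∀ {m e f j k} → j < m → k < m → blockDiag m e f j k ≡ e j k
blockDiag-fst {m} {j = j} {k} j<m k<m with j <? m | k <? m
... | yes _   | yes _   = refl
... | no  j≮m | _       = contradiction j<m j≮m
... | yes _   | no  k≮m = contradiction k<m k≮m

blockDiag-snd : ∀ m e f j k → blockDiag m e f (m + j) (m + k) ≡ f j k
blockDiag-snd m e f j k with m + j <? m | m + k <? m
... | no  _ | no  _ = cong₂ f (m+n∸m≡n m j) (m+n∸m≡n m k)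
... | yes x | _     = contradiction (m≤m+n m j) (<⇒≱ x)
... | no  _ | yes y = contradiction (m≤m+n m k) (<⇒≱ y)

blockDiag-off : ∀ {m e f j k} → j < m → m ≤ k → blockDiag m e f j k ≡ 0 × blockDiag m e f k j ≡ 0
blockDiag-off {m} {j = j} {k} j<m m≤k with j <? m | k <? m
... | yes _   | no _  = refl , refl
... | no  j≮m | _     = contradiction j<m j≮m
... | yes _   | yes y = contradiction m≤k (<⇒≱ y)

_⊕_ : RawGraph → RawGraph → RawGraph
(m , A) ⊕ (n , B) = m + n , tabulate (λ a → tabulate (λ b → blockDiag m (entry A) (entry B) (toℕ a) (toℕ b)))

edges-⊕ : ∀ G H {j k} → j < size G + size H → k < size G + size H →
  edges (G ⊕ H) j k ≡ blockDiag (size G) (edges G) (edges H) j k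
edges-⊕ (m , A) (n , B) = entry-tabulate (blockDiag m (entry A) (entry B))

edges-⊕-fst : ∀ G H {j k} → j < size G → k < size G → edges (G ⊕ H) j k ≡ edges G j k
edges-⊕-fst G H j<m k<m =
  trans (edges-⊕ G H (<-≤-trans j<m (m≤m+n _ _)) (<-≤-trans k<m (m≤m+n _ _))) (blockDiag-fst j<m k<m)

edges-⊕-snd : ∀ G H {j k} → j < size H → k < size H →
  edges (G ⊕ H) (size G + j) (size G + k) ≡ edges H j k
edges-⊕-snd G H {j} {k} j<n k<n =
  trans (edges-⊕ G H (+-monoʳ-< (size G) j<n) (+-monoʳ-< (size G) k<n)) (blockDiag-snd (size G) (edges G) (edges H) j k)

Cut-⊕ : ∀ G H → Cut (G ⊕ H) (size G)
Cut-⊕ G H = cut (m≤m+n _ _) λ j<m m≤k k<m+n →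
  let j<m+n = <-≤-trans j<m (m≤m+n _ _)
      off₁ , off₂ = blockDiag-off {e = edges G} {edges H} j<m m≤k
  in trans (edges-⊕ G H j<m+n k<m+n) off₁ , trans (edges-⊕ G H k<m+n j<m+n) off₂

restrictFst-⊕ : ∀ G H → restrictFst (G ⊕ H) (size G) ≡ G
restrictFst-⊕ G H = graph-ext refl λ j<m k<m →
  trans (edges-restrictFst (G ⊕ H) j<m k<m) (edges-⊕-fst G H j<m k<m)

restrictSnd-⊕ : ∀ G H → restrictSnd (G ⊕ H) (size G) ≡ H
restrictSnd-⊕ G H = graph-ext (m+n∸m≡n (size G) (size H)) λ j<n k<n →
  let n≡ = m+n∸m≡n (size G) (size H) in
  trans (edges-restrictSnd (G ⊕ H) j<n k<n) (edges-⊕-snd G H (subst (_ <_) n≡ j<n) (subst (_ <_) n≡ k<n))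

NoIsolated-⊕ : ∀ {G H} → NoIsolated G → NoIsolated H → NoIsolated (G ⊕ H)
NoIsolated-⊕ {G} {H} noIsoG noIsoH {j} j<m+n with j <? size G
... | yes j<m =
  let k , k<m , adj = noIsoG j<m
  in k , <-≤-trans k<m (m≤m+n _ _) ,
     Adjacent-transport G (G ⊕ H) (sym (edges-⊕-fst G H j<m k<m)) (sym (edges-⊕-fst G H k<m j<m)) adj
... | no  j≮m =
  let m≤j = ≮⇒≥ j≮m
      j′<n = subst (j ∸ size G <_) (m+n∸m≡n (size G) (size H)) (∸-monoˡ-< j<m+n m≤j)
      k , k<n , adj = noIsoH j′<n
  in size G + k , +-monoʳ-< (size G) k<n ,
     subst (λ j′ → Adjacent (G ⊕ H) j′ (size G + k)) (m+[n∸m]≡n m≤j)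
       (Adjacent-transport H (G ⊕ H) (sym (edges-⊕-snd G H j′<n k<n)) (sym (edges-⊕-snd G H k<n j′<n)) adj)

-- Factorisation into irreducible graphs

∅ : RawGraph
∅ = 0 , []

data Factorisation : List RawGraph → RawGraph → Set where
  []   : Factorisation [] ∅
  cons : ∀ {H w G} → Cut G (size H) → restrictFst G (size H) ≡ H →
         Factorisation w (restrictSnd G (size H)) → Factorisation (H ∷ w) G

Factorisation-functional : ∀ {w G H} → Factorisation w G → Factorisation w H → G ≡ H
Factorisation-functional []             []                = refl
Factorisation-functional (cons c fst≡ f) (cons c′ fst≡′ f′) =
  ≡-fromCut c c′ (trans fst≡ (sym fst≡′)) (Factorisation-functional f f′)

Irreducible⇒noInnerCut : ∀ {H a} → Irreducible H → Cut H a → 0 < a → a < size H → ⊥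
Irreducible⇒noInnerCut {H} {a} (_ , _ , onlyTrivial) c 0<a a<n
  with onlyTrivial a (Equivalence.from (Admissible⇔Cut H a) c)
... | inj₁ a≡0 = contradiction a≡0 (>⇒≢ 0<a)
... | inj₂ a≡n = contradiction a≡n (<⇒≢ a<n)

Irreducible-prefix-noInnerCut : ∀ {G H a} → Irreducible H → Cut G (size H) → restrictFst G (size H) ≡ H →
  Cut G a → 0 < a → a < size H → ⊥
Irreducible-prefix-noInnerCut {G} {H} {a} irr cₕ fst≡ cₐ 0<a a<n =
  Irreducible⇒noInnerCut irr (subst (λ X → Cut X a) fst≡ (Cut-restrictFst cₐ (<⇒≤ a<n) (bounded cₕ))) 0<a a<n

Factorisation-injective : ∀ {w w′ G} → All Irreducible w → All Irreducible w′ →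
  Factorisation w G → Factorisation w′ G → w ≡ w′
Factorisation-injective [] [] [] [] = refl
Factorisation-injective [] ((_ , 0<n , _) ∷ _) [] (cons c _ _) = contradiction (bounded c) (<⇒≱ 0<n)
Factorisation-injective ((_ , 0<n , _) ∷ _) [] (cons c _ _) [] = contradiction (bounded c) (<⇒≱ 0<n)
Factorisation-injective {H ∷ w} {H′ ∷ w′} {G} (irr ∷ irrs) (irr′ ∷ irrs′) (cons c fst≡ f) (cons c′ fst≡′ f′)
  with <-cmp (size H) (size H′)
... | tri< n<n′ _ _ = ⊥-elim (Irreducible-prefix-noInnerCut irr′ c′ fst≡′ c (proj₁ (proj₂ irr)) n<n′)
... | tri> _ _ n′<n = ⊥-elim (Irreducible-prefix-noInnerCut irr c fst≡ c′ (proj₁ (proj₂ irr′)) n′<n)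
... | tri≈ _ n≡n′ _ = cong₂ _∷_ (trans (sym fst≡) (trans (cong (restrictFst G) n≡n′) fst≡′))
  (Factorisation-injective irrs irrs′ f (subst (λ n → Factorisation w′ (restrictSnd G n)) (sym n≡n′) f′))

leastWitness : ∀ {p} {P : ℕ → Set p} → Decidable P → ∀ {n} → P n →
  ∃[ i ] i ≤ n × P i × (∀ {j} → j < i → ¬ P j)
leastWitness P? {zero} p = 0 , z≤n , p , λ ()
leastWitness P? {suc n} p with P? 0
... | yes p₀ = 0 , z≤n , p₀ , λ ()
... | no ¬p₀ =
  let i , i≤n , pᵢ , below = leastWitness (P? ∘ suc) p
  in suc i , s≤s i≤n , pᵢ , λ { {zero} _ → ¬p₀ ; {suc j} (s≤s j<i) → below j<i }

Irreducible-leastCut : ∀ {G i} → NoIsolated G → Cut G (suc i) → (∀ {j} → j < i → ¬ Cut G (suc j)) →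
  Irreducible (restrictFst G (suc i))
Irreducible-leastCut {G@(_ , _)} {i} noIso c least =
  Equivalence.from (IsGraph⇔NoIsolated (restrictFst G (suc i))) (NoIsolated-restrictFst noIso c) , s≤s z≤n , onlyTrivial
  where
    onlyTrivial : ∀ j → Admissible (restrictFst G (suc i)) j → j ≡ 0 ⊎ j ≡ suc i
    onlyTrivial zero    _   = inj₁ refl
    onlyTrivial (suc j) adm =
      [ (λ { (s≤s j<i) → contradiction (Cut-fromRestrictFst c cⱼ) (least j<i) }) , inj₂ ]′
        (m≤n⇒m<n∨m≡n (bounded cⱼ))
      where cⱼ = Equivalence.to (Admissible⇔Cut _ (suc j)) adm

factorise : ∀ G → NoIsolated G → ∃[ w ] All Irreducible w × Factorisation w G
factorise G = go (size G) G ≤-refl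
  where
    go : ∀ n G → size G ≤ n → NoIsolated G → ∃[ w ] All Irreducible w × Factorisation w G
    go _       (zero  , []) _         _     = [] , [] , []
    go (suc n) (suc m , A)  (s≤s m≤n) noIso =
      let i , _ , cᵢ , least = leastWitness (Cut? (suc m , A) ∘ suc) (Cut-size (suc m , A))
          w , irrs , f = go n (restrictSnd (suc m , A) (suc i)) (≤-trans (m∸n≤m m i) m≤n)
                           (NoIsolated-restrictSnd noIso cᵢ)
      in restrictFst (suc m , A) (suc i) ∷ w , Irreducible-leastCut noIso cᵢ least ∷ irrs , cons cᵢ refl f

⨁ : List RawGraph → RawGraph
⨁ = foldr _⊕_ ∅

Factorisation-⨁ : ∀ w → Factorisation w (⨁ w)
Factorisation-⨁ []      = []
Factorisation-⨁ (H ∷ w) = cons (Cut-⊕ H (⨁ w)) (restrictFst-⊕ H (⨁ w))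
  (subst (Factorisation w) (sym (restrictSnd-⊕ H (⨁ w))) (Factorisation-⨁ w))

NoIsolated-⨁ : ∀ {w} → All NoIsolated w → NoIsolated (⨁ w)
NoIsolated-⨁                 []               ()
NoIsolated-⨁ {H ∷ w} (noIso ∷ noIsos) = NoIsolated-⊕ {H} {⨁ w} noIso (NoIsolated-⨁ noIsos)

-- The junk value [] on non-graphs is harmless: only graphs are ever expanded.
irreducibleFactors : RawGraph → List RawGraph
irreducibleFactors G with IsGraph? G
... | yes g = proj₁ (factorise G (Equivalence.to (IsGraph⇔NoIsolated G) g))
... | no  _ = []

irreducibleFactors-irreducible : ∀ G → All Irreducible (irreducibleFactors G)
irreducibleFactors-irreducible G with IsGraph? G
... | yes g = proj₁ (proj₂ (factorise G (Equivalence.to (IsGraph⇔NoIsolated G) g)))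
... | no  _ = []

irreducibleFactors-factorisation : ∀ G → IsGraph G → Factorisation (irreducibleFactors G) G
irreducibleFactors-factorisation G g with IsGraph? G
... | yes g′ = proj₂ (proj₂ (factorise G (Equivalence.to (IsGraph⇔NoIsolated G) g′)))
... | no ¬g  = contradiction g ¬g

Irreducible⇒NoIsolated : ∀ {H} → Irreducible H → NoIsolated H
Irreducible⇒NoIsolated {H} irr = Equivalence.to (IsGraph⇔NoIsolated H) (proj₁ irr)

IsGraph-⨁ : ∀ {w} → All Irreducible w → IsGraph (⨁ w)
IsGraph-⨁ {w} irrs = Equivalence.from (IsGraph⇔NoIsolated (⨁ w)) (NoIsolated-⨁ (All.map (λ {H} → Irreducible⇒NoIsolated {H}) irrs))

-- The dual algebra

module _ {a ℓ} (M : Monoid a ℓ) where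
  open Monoid M using (Carrier; _≈_; _∙_; ε; ∙-cong; ∙-congˡ; identityˡ; identityʳ)
  open Monoid M using () renaming (refl to ≈-refl; trans to ≈-trans)

  foldr-applyUpTo-ε : ∀ h n → (∀ {j} → j < n → h j ≈ ε) → foldr _∙_ ε (applyUpTo h n) ≈ ε
  foldr-applyUpTo-ε h zero    _    = ≈-refl
  foldr-applyUpTo-ε h (suc n) h≈ε =
    ≈-trans (∙-cong (h≈ε (s≤s z≤n)) (foldr-applyUpTo-ε (h ∘ suc) n (h≈ε ∘ s≤s))) (identityʳ ε)

  foldr-applyUpTo-single : ∀ h n {t} → t < n → (∀ {j} → j < n → j ≢ t → h j ≈ ε) →
    foldr _∙_ ε (applyUpTo h n) ≈ h t
  foldr-applyUpTo-single h (suc n) {zero} _ h≈ε =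
    ≈-trans (∙-congˡ (foldr-applyUpTo-ε (h ∘ suc) n λ j<n → h≈ε (s≤s j<n) λ ())) (identityʳ (h 0))
  foldr-applyUpTo-single h (suc n) {suc t} (s≤s t<n) h≈ε =
    ≈-trans (∙-cong (h≈ε (s≤s z≤n) λ ())
                  (foldr-applyUpTo-single (h ∘ suc) n t<n λ j<n j≢t → h≈ε (s≤s j<n) (j≢t ∘ suc-injective)))
          (identityˡ (h (suc t)))

if-T : ∀ {a b} {A : Set a} {x y : A} → T b → (if b then x else y) ≡ x
if-T {b = true} _ = refl

module FreeAlgebra {c ℓ} (K : CharZeroField c ℓ) where
  open CharZeroField K
    renaming (_+_ to _+ᴷ_)
    using (Carrier; _≈_; _*_; 0#; 1#; setoid; +-monoid; +-cong; +-identityˡ; +-identityʳ;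
           *-congʳ; *-congˡ; *-identityˡ; *-identityʳ; zeroˡ; zeroʳ)
  open GSym K
  open import Relation.Binary.Reasoning.Setoid setoid
  module ≈ = Setoid setoid

  if-then-0 : ∀ b {x} → (T b → x ≈ 0#) → (if b then x else 0#) ≈ 0#
  if-then-0 true  x≈0 = x≈0 _
  if-then-0 false _   = ≈.refl

  S-≡ : ∀ {H X} → X ≡ H → S H X ≡ 1#
  S-≡ {H} {X} X≡H = cong (λ b → if b then 1# else 0#) (dec-true (H ≟G X) (sym X≡H))

  S-≢ : ∀ {H X} → X ≢ H → S H X ≡ 0#
  S-≢ {H} {X} X≢H = cong (λ b → if b then 1# else 0#) (dec-false (H ≟G X) (X≢H ∘ sym))

  cutTerm : Elt → Elt → RawGraph → ℕ → Carrier
  cutTerm f g G i = if admissibleᵇ (proj₂ G) i then f (restrictFst G i) * g (restrictSnd G i) else 0#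

  ·-as-foldr : ∀ f g G → (f · g) G ≡ foldr _+ᴷ_ 0# (applyUpTo (cutTerm f g G) (suc (size G)))
  ·-as-foldr f g G = cong (foldr _+ᴷ_ 0#) (map-upTo (cutTerm f g G) (suc (size G)))

  ·-single : ∀ f g G {t} → t ≤ size G → (∀ {i} → i ≢ t → cutTerm f g G i ≈ 0#) →
    (f · g) G ≈ cutTerm f g G t
  ·-single f g G t≤m vanish = ≈.trans (≈.reflexive (·-as-foldr f g G))
    (foldr-applyUpTo-single +-monoid (cutTerm f g G) (suc (size G)) (s≤s t≤m) (λ _ → vanish))

  ·-zero : ∀ f g G → (∀ {i} → i ≤ size G → cutTerm f g G i ≈ 0#) → (f · g) G ≈ 0#
  ·-zero f g G vanish = ≈.trans (≈.reflexive (·-as-foldr f g G))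
    (foldr-applyUpTo-ε +-monoid (cutTerm f g G) (suc (size G)) (vanish ∘ s≤s⁻¹))

  cutTerm-S-≢ : ∀ H g G {i} → i ≢ size H → cutTerm (S H) g G i ≈ 0#
  cutTerm-S-≢ H g (m , A) {i} i≢n = if-then-0 (admissibleᵇ A i) λ _ →
    ≈.trans (*-congʳ (≈.reflexive (S-≢ (i≢n ∘ cong size)))) (zeroˡ _)

  mono-∷ : ∀ {H w G} → Cut G (size H) → restrictFst G (size H) ≡ H →
    mono (H ∷ w) G ≈ mono w (restrictSnd G (size H))
  mono-∷ {H} {w} {G} c fst≡ = begin
    (S H · mono w) G                                                  ≈⟨ ·-single (S H) (mono w) G (bounded c) (cutTerm-S-≢ H (mono w) G) ⟩
    cutTerm (S H) (mono w) G (size H)                                 ≡⟨ if-T (Equivalence.from (Admissible⇔Cut G (size H)) c) ⟩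
    S H (restrictFst G (size H)) * mono w (restrictSnd G (size H))    ≈⟨ *-congʳ (≈.reflexive (S-≡ fst≡)) ⟩
    1# * mono w (restrictSnd G (size H))                              ≈⟨ *-identityˡ _ ⟩
    mono w (restrictSnd G (size H))                                   ∎

  mono-∷-≈0 : ∀ {H w G} → (Cut G (size H) → restrictFst G (size H) ≡ H → mono w (restrictSnd G (size H)) ≈ 0#) →
    mono (H ∷ w) G ≈ 0#
  mono-∷-≈0 {H} {w} {G@(m , A)} rest≈0 with size H ≤? m
  ... | no  n≰m = ·-zero (S H) (mono w) G λ i≤m → cutTerm-S-≢ H (mono w) G λ { refl → n≰m i≤m }
  ... | yes n≤m = ≈.trans (·-single (S H) (mono w) G n≤m (cutTerm-S-≢ H (mono w) G))
    (if-then-0 (admissibleᵇ A (size H)) λ adm → term≈0 (Equivalence.to (Admissible⇔Cut G (size H)) adm))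
    where
      term≈0 : Cut G (size H) → S H (restrictFst G (size H)) * mono w (restrictSnd G (size H)) ≈ 0#
      term≈0 c with restrictFst G (size H) ≟G H
      ... | yes fst≡ = ≈.trans (*-congˡ (rest≈0 c fst≡)) (zeroʳ _)
      ... | no  fst≢ = ≈.trans (*-congʳ (≈.reflexive (S-≢ fst≢))) (zeroˡ _)

  mono-factorisation : ∀ {w G} → Factorisation w G → mono w G ≈ 1#
  mono-factorisation          []              = ≈.refl
  mono-factorisation {H ∷ w} (cons c fst≡ f) = ≈.trans (mono-∷ {w = w} c fst≡) (mono-factorisation f)

  mono-¬factorisation : ∀ {w G} → ¬ Factorisation w G → mono w G ≈ 0#
  mono-¬factorisation {[]} {G} ¬f with ∅ ≟G G
  ... | yes refl = contradiction [] ¬f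
  ... | no  _    = ≈.refl
  mono-¬factorisation {H ∷ w} ¬f = mono-∷-≈0 {w = w} λ c fst≡ → mono-¬factorisation (¬f ∘ cons c fst≡)

  expansion : Elt → List RawGraph → List (Carrier × Word)
  expansion f = map (λ G → f G , irreducibleFactors G)

  lincomb-expansion-∉ : ∀ f {L G′} → All IsGraph L → G′ ∉ L → lincomb (expansion f L) G′ ≈ 0#
  lincomb-expansion-∉ f               []       _   = ≈.refl
  lincomb-expansion-∉ f {G ∷ L} {G′} (g ∷ gs) G′∉ = begin
    f G * mono (irreducibleFactors G) G′ +ᴷ lincomb (expansion f L) G′
      ≈⟨ +-cong (≈.trans (*-congˡ (mono-¬factorisation G≢G′)) (zeroʳ _)) (lincomb-expansion-∉ f gs (G′∉ ∘ there)) ⟩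
    0# +ᴷ 0#
      ≈⟨ +-identityʳ 0# ⟩
    0# ∎
    where
      G≢G′ : ¬ Factorisation (irreducibleFactors G) G′
      G≢G′ f′ = G′∉ (here (sym (Factorisation-functional (irreducibleFactors-factorisation G g) f′)))

  lincomb-expansion-∈ : ∀ f {L G′} → Unique L → All IsGraph L → G′ ∈ L → lincomb (expansion f L) G′ ≈ f G′
  lincomb-expansion-∈ f {G ∷ L} (G∉ ∷ _) (g ∷ gs) (here refl) = begin
    f G * mono (irreducibleFactors G) G +ᴷ lincomb (expansion f L) G
      ≈⟨ +-cong (≈.trans (*-congˡ (mono-factorisation (irreducibleFactors-factorisation G g))) (*-identityʳ _))
                (lincomb-expansion-∉ f gs λ G∈ → All.lookup G∉ G∈ refl) ⟩
    f G +ᴷ 0#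
      ≈⟨ +-identityʳ _ ⟩
    f G ∎
  lincomb-expansion-∈ f {G ∷ L} {G′} (G∉ ∷ u) (g ∷ gs) (there G′∈) = begin
    f G * mono (irreducibleFactors G) G′ +ᴷ lincomb (expansion f L) G′
      ≈⟨ +-cong (≈.trans (*-congˡ (mono-¬factorisation G≢G′)) (zeroʳ _)) (lincomb-expansion-∈ f u gs G′∈) ⟩
    0# +ᴷ f G′
      ≈⟨ +-identityˡ _ ⟩
    f G′ ∎
    where
      G≢G′ : ¬ Factorisation (irreducibleFactors G) G′
      G≢G′ f′ = All.lookup G∉ G′∈ (Factorisation-functional (irreducibleFactors-factorisation G g) f′)

  spanning : ∀ f → FinSupp f →
    Σ (List (Carrier × Word)) λ cs → All (λ p → All Irreducible (proj₂ p)) cs × (f ≐ lincomb cs)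
  spanning f (L , outside≈0) = expansion f graphs ,
    AllP.map⁺ (All.universal irreducibleFactors-irreducible graphs) , f≐
    where
      graphs = deduplicate _≟G_ (filter IsGraph? L)

      graphs-unique : Unique graphs
      graphs-unique = deduplicate-! (filter IsGraph? L)

      ∈-graphs⁻ : ∀ {G} → G ∈ graphs → G ∈ L × IsGraph G
      ∈-graphs⁻ = ∈-filter⁻ IsGraph? ∘ ∈-deduplicate⁻ _≟G_ _

      f≐ : f ≐ lincomb (expansion f graphs)
      f≐ G g with G ∈? L
      ... | yes G∈ = ≈.sym (lincomb-expansion-∈ f graphs-unique (All.tabulate (proj₂ ∘ ∈-graphs⁻))
                                                 (∈-deduplicate⁺ _≟G_ (∈-filter⁺ IsGraph? G∈ g)))
      ... | no  G∉ = ≈.trans (outside≈0 G g G∉)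
                       (≈.sym (lincomb-expansion-∉ f (All.tabulate (proj₂ ∘ ∈-graphs⁻)) (G∉ ∘ proj₁ ∘ ∈-graphs⁻)))

  lincomb-⨁-others : ∀ {w} cs → All Irreducible w → All (λ p → All Irreducible (proj₂ p)) cs →
    All (λ p → w ≢ proj₂ p) cs → lincomb cs (⨁ w) ≈ 0#
  lincomb-⨁-others []              _    _             _          = ≈.refl
  lincomb-⨁-others {w} ((c , w′) ∷ cs) irrs (irrs′ ∷ irrss) (w≢w′ ∷ w≢s) = begin
    c * mono w′ (⨁ w) +ᴷ lincomb cs (⨁ w)
      ≈⟨ +-cong (≈.trans (*-congˡ (mono-¬factorisation ¬f)) (zeroʳ c)) (lincomb-⨁-others cs irrs irrss w≢s) ⟩
    0# +ᴷ 0#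
      ≈⟨ +-identityʳ 0# ⟩
    0# ∎
    where
      ¬f : ¬ Factorisation w′ (⨁ w)
      ¬f = w≢w′ ∘ Factorisation-injective irrs irrs′ (Factorisation-⨁ w)

  independent : ∀ cs → All (λ p → All Irreducible (proj₂ p)) cs → Unique (map proj₂ cs) →
    lincomb cs ≐ (λ _ → 0#) → All (λ p → proj₁ p ≈ 0#) cs
  independent []              _               _         _      = []
  independent ((c , w) ∷ cs) (irrs ∷ irrss) (w∉ ∷ u) all≈0 = c≈0 ∷ independent cs irrss u rest≈0
    where
      c≈0 : c ≈ 0#
      c≈0 = begin
        c                                      ≈⟨ ≈.sym (+-identityʳ c) ⟩
        c +ᴷ 0#                                ≈⟨ ≈.sym (+-cong (≈.trans (*-congˡ (mono-factorisation (Factorisation-⨁ w))) (*-identityʳ c))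
                                                              (lincomb-⨁-others cs irrs irrss (AllP.map⁻ w∉))) ⟩
        c * mono w (⨁ w) +ᴷ lincomb cs (⨁ w)  ≈⟨ all≈0 (⨁ w) (IsGraph-⨁ irrs) ⟩
        0#                                     ∎
      rest≈0 : lincomb cs ≐ (λ _ → 0#)
      rest≈0 G g = begin
        lincomb cs G                         ≈⟨ ≈.sym (+-identityˡ _) ⟩
        0# +ᴷ lincomb cs G                   ≈⟨ +-cong (≈.sym (≈.trans (*-congʳ c≈0) (zeroˡ _))) ≈.refl ⟩
        c * mono w G +ᴷ lincomb cs G         ≈⟨ all≈0 G g ⟩
        0#                                   ∎

mainTheorem2 : ∀ {c ℓ : Level} (K : CharZeroField c ℓ) → GSym.IsFreeOnIrreducibles K
mainTheorem2 K = spanning , independent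
  where open FreeAlgebra K
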